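{- Let $n\geq k\geq 1$, let $S\neq T$ be $k$-subsets of $[n]$, and let $C$ be a non-trivial component of $h(S,T)$. Then $x_{min}(C)$ and $y_{max}(C)$ are adjacent in $h(S,T)$.
   Context: $[m]=\{1,\dots,m\}$. For a $k$-subset $S$ of $[n]$ define $f(S)\subseteq([n]\setminus[k])\times[k]$: if $S=[k]$ then $f(S)=\emptyset$; otherwise let $S\setminus[k]=\{x_1,\dots,x_t\}$ with $n\geq x_1>\dots>x_t\geq k+1$ and $[k]\setminus S=\{y_1,\dots,y_t\}$ with $1\leq y_1<\dots<y_t\leq k$, and set $f(S)=\{(x_1,y_1),\dots,(x_t,y_t)\}$. Let $h(S)$ be the graph on $[n]$ whose edges are the pairs $\{x,y\}$ with $(x,y)\in f(S)$, and $h(S,T)$ the multigraph union of $h(S)$ and $h(T)$. A non-trivial component is a connected component with at least one edge. For such $C$ (viewed as its vertex set): $x_{min}(C)=\min(C\cap([n]\setminus[k]))$, $y_{max}(C)=\max(C\cap[k])$. -}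

module Defs where

open import Data.Nat using (ℕ; zero; suc; _<_; _≤_; _<ᵇ_)
open import Data.Nat.Properties using (_<?_)
open import Data.Bool using (Bool; true; false; not; _∧_)
open import Data.Fin using (Fin; fromℕ<)
open import Data.Fin.Subset using (Subset)
open import Data.Vec using (lookup)
open import Data.List using (List; []; _∷_; map; upTo; downFrom; filterᵇ; zip; _++_)
open import Data.List.Membership.Propositional using (_∈_)
open import Data.Product using (_×_; _,_)
open import Data.Sum using (_⊎_)
open import Relation.Nullary using (yes; no)

-- Convention: a subset S of [n] = {1,…,n} is a 'Subset n'; the element
-- 'i : Fin n' stands for the number  toℕ i + 1.

memB : ∀ {n} → Subset n → ℕ → Bool
memB S zero = false
memB {n} S (suc j) with j <? n
... | yes p = lookup S (fromℕ< p)
... | no _  = false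

-- S \ [k], listed decreasingly:  x₁ > x₂ > … > x_t  (all in [n] \ [k]).
xsOf : ∀ {n} → ℕ → Subset n → List ℕ
xsOf {n} k S = filterᵇ (λ x → (k <ᵇ x) ∧ memB S x) (map suc (downFrom n))

-- [k] \ S, listed increasingly:  y₁ < y₂ < … < y_t.
ysOf : ∀ {n} → ℕ → Subset n → List ℕ
ysOf k S = filterᵇ (λ y → not (memB S y)) (map suc (upTo k))

-- f(S) = {(x₁,y₁),…,(x_t,y_t)} ⊆ ([n]\[k]) × [k]  (empty when S = [k]).
f : ∀ {n} → ℕ → Subset n → List (ℕ × ℕ)
f k S = zip (xsOf k S) (ysOf k S)

-- Edge list of the multigraph h(S,T) = h(S) ∪ h(T); an edge {x,y} is
-- recorded as the pair (x,y) ∈ f(S) or f(T).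
hEdges : ∀ {n} → ℕ → Subset n → Subset n → List (ℕ × ℕ)
hEdges k S T = f k S ++ f k T

Adj : List (ℕ × ℕ) → ℕ → ℕ → Set
Adj E u v = ((u , v) ∈ E) ⊎ ((v , u) ∈ E)

data Reach (E : List (ℕ × ℕ)) : ℕ → ℕ → Set where
  here : ∀ {u} → Reach E u u
  step : ∀ {u w v} → Adj E u w → Reach E w v → Reach E u v

-- The non-trivial components are exactly the vertex sets
--   C = { v | Reach E x₀ v }  with (x₀ , y₀) ∈ E  an edge.
-- x_min(C) = min (C ∩ ([n] \ [k])) :
IsXmin : List (ℕ × ℕ) → ℕ → ℕ → ℕ → Set
IsXmin E k x₀ m = Reach E x₀ m × k < m × (∀ v → Reach E x₀ v → k < v → m ≤ v)

IsYmax : List (ℕ × ℕ) → ℕ → ℕ → ℕ → Set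
IsYmax E k x₀ m = Reach E x₀ m × 1 ≤ m × m ≤ k × (∀ v → Reach E x₀ v → 1 ≤ v → v ≤ k → v ≤ m)

-- Both f(S) and f(T) pair a decreasing list of upper vertices with an increasing
-- list of lower vertices, so each is a matching on which x ≤ x' iff y' ≤ y.
-- If x_min(C) and y_max(C) have their edges in the same matching, this order
-- reversal forces the partner of x_min(C) to be y_max(C).  Otherwise, say x_min(C)
-- has an f(S)-edge but no f(T)-edge; then C is an alternating path starting at
-- x_min(C) with an f(S)-edge, so every lower vertex of C, y_max(C) included, is
-- entered through an f(S)-edge, and we are back in the first case.
module Submission where

open import Defs
open import Data.Nat using (ℕ; suc; _≤_; _<_; _>_; _≟_; _<ᵇ_; z≤n; s≤s; s<s)
open import Data.Nat.Properties using (≤-refl; ≤-antisym; <⇒≤; <⇒≱; <ᵇ⇒<)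
open import Data.Bool using (Bool; not; _∧_)
open import Data.Bool.Properties using (T?; T-∧)
open import Data.Fin.Subset using (Subset; ∣_∣)
open import Data.Product using (_×_; _,_; proj₁; proj₂; ∃-syntax)
open import Data.Sum using (_⊎_; inj₁; inj₂; swap; [_,_])
open import Data.Empty using (⊥-elim)
open import Data.List using (List; _∷_; map; upTo; downFrom; zip)
open import Data.List.Relation.Unary.All as All using (All)
open import Data.List.Relation.Unary.AllPairs using (AllPairs; _∷_)
import Data.List.Relation.Unary.AllPairs.Properties as AllPairs
open import Data.List.Relation.Unary.Any using (here; there; any?)
open import Data.List.Membership.Propositional using (_∈_; _∉_; find; lose)
open import Data.List.Membership.Propositional.Properties
  using (∈-++⁻; ∈-++⁺ˡ; ∈-++⁺ʳ; ∈-filter⁻; ∈-map⁻; ∈-upTo⁻)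
open import Data.List.Relation.Binary.Subset.Propositional using (_⊆_)
open import Function using (_∘_)
open import Function.Bundles using (_⇔_; mk⇔; Equivalence)
open import Relation.Nullary using (yes; no)
open import Relation.Binary.PropositionalEquality using (_≡_; _≢_; refl; subst)

open Equivalence using (to; from)

∈-zip⁻ : ∀ {A B : Set} {xs : List A} {ys : List B} {x y} →
         (x , y) ∈ zip xs ys → x ∈ xs × y ∈ ys
∈-zip⁻ {xs = _ ∷ _} {_ ∷ _} (here refl) = here refl , here refl
∈-zip⁻ {xs = _ ∷ _} {_ ∷ _} (there p) with x∈ , y∈ ← ∈-zip⁻ p = there x∈ , there y∈

zip-antitone : ∀ {xs ys} → AllPairs _>_ xs → AllPairs _<_ ys →
               ∀ {x y x' y'} → (x , y) ∈ zip xs ys → (x' , y') ∈ zip xs ys →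
               x ≤ x' ⇔ y' ≤ y
zip-antitone {_ ∷ _} {_ ∷ _} _ _ (here refl) (here refl) = mk⇔ (λ _ → ≤-refl) (λ _ → ≤-refl)
zip-antitone {_ ∷ _} {_ ∷ _} (x>xs ∷ _) (y<ys ∷ _) (here refl) (there q)
  with x'∈ , y'∈ ← ∈-zip⁻ q =
  mk⇔ (⊥-elim ∘ <⇒≱ (All.lookup x>xs x'∈)) (⊥-elim ∘ <⇒≱ (All.lookup y<ys y'∈))
zip-antitone {_ ∷ _} {_ ∷ _} (x'>xs ∷ _) (y'<ys ∷ _) (there p) (here refl)
  with x∈ , y∈ ← ∈-zip⁻ p =
  mk⇔ (λ _ → <⇒≤ (All.lookup y'<ys y∈)) (λ _ → <⇒≤ (All.lookup x'>xs x∈))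
zip-antitone {_ ∷ _} {_ ∷ _} (_ ∷ xs>) (_ ∷ ys<) (there p) (there q) = zip-antitone xs> ys< p q

Crossing : ℕ → ℕ → ℕ → Set
Crossing k x y = k < x × 1 ≤ y × y ≤ k

record AntitoneMatching (k : ℕ) (L : List (ℕ × ℕ)) : Set where
  field
    crossing : ∀ {x y} → (x , y) ∈ L → Crossing k x y
    antitone : ∀ {x y x' y'} → (x , y) ∈ L → (x' , y') ∈ L → x ≤ x' ⇔ y' ≤ y

  partner-unique : ∀ {x y y'} → (x , y) ∈ L → (x , y') ∈ L → y ≡ y'
  partner-unique p q = ≤-antisym (to (antitone q p) ≤-refl) (to (antitone p q) ≤-refl)

  partner-injective : ∀ {x x' y} → (x , y) ∈ L → (x' , y) ∈ L → x ≡ x'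
  partner-injective p q = ≤-antisym (from (antitone p q) ≤-refl) (from (antitone q p) ≤-refl)

f-antitoneMatching : ∀ {n} k (S : Subset n) → AntitoneMatching k (f k S)
f-antitoneMatching {n} k S = record
  { crossing = λ p → let x∈ , y∈ = ∈-zip⁻ p in above x∈ , below y∈
  ; antitone = zip-antitone
      (AllPairs.filter⁺ (T? ∘ upperIn) (AllPairs.map⁺ (AllPairs.applyDownFrom⁺₁ _ n λ j<i _ → s<s j<i)))
      (AllPairs.filter⁺ (T? ∘ lowerOut) (AllPairs.map⁺ (AllPairs.applyUpTo⁺₁ _ k λ i<j _ → s<s i<j)))
  }
  where
  upperIn lowerOut : ℕ → Bool
  upperIn x = (k <ᵇ x) ∧ memB S x
  lowerOut y = not (memB S y)

  above : ∀ {x} → x ∈ xsOf k S → k < x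
  above x∈ = <ᵇ⇒< k _ (proj₁ (to T-∧ (proj₂ (∈-filter⁻ (T? ∘ upperIn) {xs = map suc (downFrom n)} x∈))))

  below : ∀ {y} → y ∈ ysOf k S → 1 ≤ y × y ≤ k
  below y∈ with i , i∈ , refl ← ∈-map⁻ suc (proj₁ (∈-filter⁻ (T? ∘ lowerOut) {xs = map suc (upTo k)} y∈)) =
    s≤s z≤n , ∈-upTo⁻ i∈

module _ {E : List (ℕ × ℕ)} where

  Reach-trans : ∀ {u v w} → Reach E u v → Reach E v w → Reach E u w
  Reach-trans here        r' = r'
  Reach-trans (step a r) r' = step a (Reach-trans r r')

  Reach-snoc : ∀ {u v w} → Reach E u v → Adj E v w → Reach E u w
  Reach-snoc r a = Reach-trans r (step a here)

  Reach-reverse : ∀ {u v} → Reach E u v → Reach E v u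
  Reach-reverse here       = here
  Reach-reverse (step a r) = Reach-snoc (Reach-reverse r) (swap a)

  Reach-incident : ∀ {x₀ y₀ v} → (x₀ , y₀) ∈ E → Reach E x₀ v → ∃[ w ] Adj E v w
  Reach-incident {y₀ = y₀} e r with Reach-reverse r
  ... | here     = y₀ , inj₁ e
  ... | step a _ = _ , a

module _ {k : ℕ} {E : List (ℕ × ℕ)} (crossingᴱ : ∀ {x y} → (x , y) ∈ E → Crossing k x y) where

  Adj-upper : ∀ {u v} → k < u → Adj E u v → (u , v) ∈ E
  Adj-upper k<u (inj₁ e) = e
  Adj-upper k<u (inj₂ e) = ⊥-elim (<⇒≱ k<u (proj₂ (proj₂ (crossingᴱ e))))

  Adj-lower : ∀ {u v} → u ≤ k → Adj E u v → (v , u) ∈ E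
  Adj-lower u≤k (inj₁ e) = ⊥-elim (<⇒≱ (proj₁ (crossingᴱ e)) u≤k)
  Adj-lower u≤k (inj₂ e) = e

  xmin-ymax-adjacent-within : ∀ {L x₀ xm ym a x'} → L ⊆ E → AntitoneMatching k L →
    IsXmin E k x₀ xm → IsYmax E k x₀ ym → (xm , a) ∈ L → (x' , ym) ∈ L → Adj E xm ym
  xmin-ymax-adjacent-within {xm = xm} {ym} {a} {x'} L⊆E M (rm , _ , minimal) (rM , _ , _ , maximal) p q =
    inj₁ (subst (λ z → (xm , z) ∈ E) a≡ym (L⊆E p))
    where
    open AntitoneMatching M
    ym≤a : ym ≤ a
    ym≤a = to (antitone p q) (minimal x' (Reach-snoc rM (inj₂ (L⊆E q))) (proj₁ (crossing q)))
    a≤ym : a ≤ ym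
    a≤ym = let _ , 1≤a , a≤k = crossing p in maximal a (Reach-snoc rm (inj₁ (L⊆E p))) 1≤a a≤k
    a≡ym : a ≡ ym
    a≡ym = ≤-antisym a≤ym ym≤a

module _ {k : ℕ} {E L₁ L₂ : List (ℕ × ℕ)} (M₁ : AntitoneMatching k L₁) (M₂ : AntitoneMatching k L₂)
         (split : ∀ {e} → e ∈ E → e ∈ L₁ ⊎ e ∈ L₂) where

  private
    module M₁ = AntitoneMatching M₁
    module M₂ = AntitoneMatching M₂

  crossingᴱ : ∀ {x y} → (x , y) ∈ E → Crossing k x y
  crossingᴱ e with split e
  ... | inj₁ e₁ = M₁.crossing e₁
  ... | inj₂ e₂ = M₂.crossing e₂

  -- Walks from m that leave every upper vertex by an L₁-edge and every lower
  -- vertex by an L₂-edge; since m has no L₂-edge they exhaust the component of m.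
  module AlternatingFrom (m : ℕ) (k<m : k < m) (m∉L₂ : ∀ {y} → (m , y) ∉ L₂) where

    data Upper : ℕ → Set
    data Lower : ℕ → Set
    data Upper where
      start : Upper m
      via₂  : ∀ {x y} → Lower y → (x , y) ∈ L₂ → Upper x
    data Lower where
      via₁  : ∀ {x y} → Upper x → (x , y) ∈ L₁ → Lower y

    Upper-above : ∀ {u} → Upper u → k < u
    Upper-above start      = k<m
    Upper-above (via₂ _ e) = proj₁ (M₂.crossing e)

    Lower-below : ∀ {u} → Lower u → u ≤ k
    Lower-below (via₁ _ e) = proj₂ (proj₂ (M₁.crossing e))

    Visited : ℕ → Set
    Visited u = Upper u ⊎ Lower u

    Visited-closed : ∀ {u v} → Visited u → Adj E u v → Visited v
    Visited-closed (inj₁ up) a with split (Adj-upper crossingᴱ (Upper-above up) a)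
    ... | inj₁ e₁ = inj₂ (via₁ up e₁)
    Visited-closed (inj₁ start)        a | inj₂ e₂ = ⊥-elim (m∉L₂ e₂)
    Visited-closed (inj₁ (via₂ lo e)) a | inj₂ e₂ = inj₂ (subst Lower (M₂.partner-unique e e₂) lo)
    Visited-closed (inj₂ lo) a with split (Adj-lower crossingᴱ (Lower-below lo) a) | lo
    ... | inj₁ e₁ | via₁ up e = inj₁ (subst Upper (M₁.partner-injective e e₁) up)
    ... | inj₂ e₂ | _         = inj₁ (via₂ lo e₂)

    Reach-visited : ∀ {v} → Reach E m v → Visited v
    Reach-visited = go (inj₁ start)
      where
      go : ∀ {u v} → Visited u → Reach E u v → Visited v
      go vu here       = vu
      go vu (step a r) = go (Visited-closed vu a) r

    L₁-partner : ∀ {v} → Reach E m v → v ≤ k → ∃[ x ] (x , v) ∈ L₁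
    L₁-partner r v≤k with Reach-visited r
    ... | inj₁ up         = ⊥-elim (<⇒≱ (Upper-above up) v≤k)
    ... | inj₂ (via₁ _ e) = _ , e

  xmin-ymax-adjacent : ∀ {x₀ y₀ xm ym a} → L₁ ⊆ E → L₂ ⊆ E → (x₀ , y₀) ∈ E →
    IsXmin E k x₀ xm → IsYmax E k x₀ ym → (xm , a) ∈ L₁ → Adj E xm ym
  xmin-ymax-adjacent {xm = xm} L₁⊆E L₂⊆E e isXmin@(rm , k<xm , _) isYmax@(rM , _ , ym≤k , _) p
    with split (Adj-lower crossingᴱ ym≤k (proj₂ (Reach-incident e rM)))
  ... | inj₁ q = xmin-ymax-adjacent-within crossingᴱ L₁⊆E M₁ isXmin isYmax p q
  ... | inj₂ q with any? (λ e₂ → proj₁ e₂ ≟ xm) L₂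
  ...   | yes xm∈L₂ with _ , p₂ , refl ← find xm∈L₂ =
                  xmin-ymax-adjacent-within crossingᴱ L₂⊆E M₂ isXmin isYmax p₂ q
  ...   | no xm∉L₂ =
                  xmin-ymax-adjacent-within crossingᴱ L₁⊆E M₁ isXmin isYmax p
                    (proj₂ (L₁-partner (Reach-trans (Reach-reverse rm) rM) ym≤k))
    where open AlternatingFrom xm k<xm (λ p₂ → xm∉L₂ (lose p₂ refl))

mainTheorem9 : (n k : ℕ) → 1 ≤ k → k ≤ n → (S T : Subset n) → ∣ S ∣ ≡ k → ∣ T ∣ ≡ k → S ≢ T
    → (x₀ y₀ : ℕ) → (x₀ , y₀) ∈ hEdges k S T
    → (xm ym : ℕ) → IsXmin (hEdges k S T) k x₀ xm → IsYmax (hEdges k S T) k x₀ ym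
    → Adj (hEdges k S T) xm ym
mainTheorem9 _ k _ _ S T _ _ _ _ _ e xm ym isXmin@(rm , k<xm , _) isYmax =
  [ xmin-ymax-adjacent Mₛ Mₜ split ∈-++⁺ˡ (∈-++⁺ʳ _) e isXmin isYmax
  , xmin-ymax-adjacent Mₜ Mₛ (swap ∘ split) (∈-++⁺ʳ _) ∈-++⁺ˡ e isXmin isYmax
  ] (split (Adj-upper (crossingᴱ Mₛ Mₜ split) k<xm (proj₂ (Reach-incident e rm))))
  where
  Mₛ : AntitoneMatching k (f k S)
  Mₛ = f-antitoneMatching k S
  Mₜ : AntitoneMatching k (f k T)
  Mₜ = f-antitoneMatching k T
  split : ∀ {e} → e ∈ hEdges k S T → e ∈ f k S ⊎ e ∈ f k T
  split = ∈-++⁻ (f k S)
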